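{- Let $U$ be a finite set, $F$ a family of subsets of $U$, and $k$ an integer. Let $G(U,F)$ be the graph constructed from $U$ and $F$ as described in the context. If there exists a minimal $a,b$-separator $S$ of $G(U,F)$ with $S \subseteq V(G(U,F)) \setminus \{a\}$, $U \subseteq S$, and $|S| \le |U| + |F| + k$, then there is a subset $F' \subseteq F$ with $|F'| \le k$ and $U = \bigcup_{T \in F'} T$.
   Context: The graph $G(U,F)$ has vertex set consisting of two vertices $a,b$, a vertex for each element $z \in U$ (identified with $z$), and for each set $T \in F$ three vertices $v_T, u_T, w_T$. Its edges are: $a$ is adjacent to every $z \in U$ and to every $u_T, w_T$ ($T \in F$); $b$ is adjacent to every $v_T$ ($T \in F$); $u_T$ and $w_T$ are each adjacent to $v_T$ (and to $a$ only besides); and $z \in U$ is adjacent to $v_T$ whenever $z \in T$. Thus $N(a) = U \cup \{u_T, w_T : T \in F\}$ and $N(b) = \{v_T : T \in F\}$. A minimal $a,b$-separator is a vertex set $S$ such that $a$ and $b$ lie in different connected components of the graph obtained by deleting $S$, inclusion-wise minimal with this property. -}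

module Defs where

open import Data.Nat using (ℕ)
open import Data.Bool using (Bool; true; false; if_then_else_)
open import Data.Fin using (Fin)
open import Data.Fin.Subset using (Subset; _∈_)
open import Data.List using (List; _∷_; _++_; map; allFin)
open import Data.Nat.ListAction using (sum)
open import Data.Sum using (_⊎_)
open import Data.Product using (_×_)
open import Relation.Binary.PropositionalEquality using (_≡_)
open import Relation.Nullary using (¬_)

-- The ground set U is Fin n; the family F is an indexed family
-- F : Fin m → Subset n (so |F| = m).

data Vtx (n m : ℕ) : Set where
  a b : Vtx n m
  el  : Fin n → Vtx n m
  v u w : Fin m → Vtx n m      -- v_T, u_T, w_T for T = F i

data Edge {n m : ℕ} (F : Fin m → Subset n) : Vtx n m → Vtx n m → Set where
  a-el : (z : Fin n) → Edge F a (el z)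
  a-u  : (i : Fin m) → Edge F a (u i)
  a-w  : (i : Fin m) → Edge F a (w i)
  b-v  : (i : Fin m) → Edge F b (v i)
  u-v  : (i : Fin m) → Edge F (u i) (v i)
  w-v  : (i : Fin m) → Edge F (w i) (v i)
  el-v : (z : Fin n) (i : Fin m) → z ∈ F i → Edge F (el z) (v i)

Adj : {n m : ℕ} (F : Fin m → Subset n) → Vtx n m → Vtx n m → Set
Adj F x y = Edge F x y ⊎ Edge F y x

VSet : ℕ → ℕ → Set
VSet n m = Vtx n m → Bool

_⊆V_ : {n m : ℕ} → VSet n m → VSet n m → Set
S ⊆V S' = ∀ x → S x ≡ true → S' x ≡ true

-- Explicit enumeration of all vertices (each exactly once).
allV : (n m : ℕ) → List (Vtx n m)
allV n m = a ∷ b ∷ (map el (allFin n) ++ map v (allFin m)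
                   ++ map u (allFin m) ++ map w (allFin m))

card : {n m : ℕ} → VSet n m → ℕ
card {n} {m} S = sum (map (λ x → if S x then 1 else 0) (allV n m))

data Reach {n m : ℕ} (F : Fin m → Subset n) (S : VSet n m) :
           Vtx n m → Vtx n m → Set where
  here : ∀ {x} → S x ≡ false → Reach F S x x
  step : ∀ {x y z} → Reach F S x y → Adj F y z → S z ≡ false → Reach F S x z

Separator : {n m : ℕ} (F : Fin m → Subset n) → VSet n m → Set
Separator F S = S a ≡ false × S b ≡ false × ¬ Reach F S a b

MinimalSeparator : {n m : ℕ} (F : Fin m → Subset n) → VSet n m → Set
MinimalSeparator F S =
  Separator F S × (∀ S' → S' ⊆V S → Separator F S' → S ⊆V S')

-- If v_T survives (v_T ∉ S) then u_T and w_T must both lie in S, so every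
-- set T costs S at least one vertex, and two if v_T survives; the elements
-- cost one each. Hence |S| ≤ |U| + |F| + k leaves at most k surviving
-- v_T. Minimality makes the surviving sets cover U: if every v_T with
-- z ∈ T were in S, the only neighbour of z outside S would be a, so z
-- could be dropped from S and S would not be minimal.
module Submission where

open import Defs
open import Data.Nat using (ℕ)
open import Data.Integer using (ℤ; +_; _+_; -_; _≤_; +≤+)
open import Data.Bool using (Bool; true; false; not; if_then_else_)
open import Data.Fin using (Fin; zero; suc)
open import Data.Fin.Subset using (Subset; _∈_; ∣_∣)
open import Data.Product using (∃; _×_; _,_)
open import Function.Definitions using (Injective)
open import Relation.Binary.PropositionalEquality
  using (_≡_; refl; sym; trans; cong; cong₂)

open import Data.Empty using (⊥-elim)
open import Data.Fin.Properties using (_≟_; any?)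
open import Data.Fin.Subset.Properties using (_∈?_)
open import Data.Integer.Properties as ℤ using (+-monoʳ-≤; pos-+)
open import Data.List using (List; map; tabulate; allFin; _++_)
open import Data.List.Properties using (map-++; map-∘)
open import Data.Nat.ListAction using (sum)
open import Data.Nat.ListAction.Properties using (sum-++)
import Data.Nat as ℕ
import Data.Nat.Properties as ℕ
open import Data.Sum using (_⊎_; inj₁; inj₂)
import Data.Vec as Vec
open import Data.Vec.Properties using (lookup∘tabulate; lookup⇒[]=)
open import Function using (_∘_; id)
open import Relation.Nullary using (¬_; yes; no; does)
open import Relation.Nullary.Decidable using (_×-dec_; dec-true)
import Data.Bool.Properties as Bool

open import Algebra.Properties.CommutativeMonoid.Sum ℕ.+-0-commutativeMonoid
  using (sum-syntax; ∑-distrib-+)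

indicator : Bool → ℕ
indicator x = if x then 1 else 0

sum-map-tabulate : ∀ {A : Set} {n} (f : A → ℕ) (g : Fin n → A) →
                   sum (map f (tabulate g)) ≡ ∑[ i < n ] f (g i)
sum-map-tabulate {n = ℕ.zero}  f g = refl
sum-map-tabulate {n = ℕ.suc n} f g = cong (f (g zero) ℕ.+_) (sum-map-tabulate f (g ∘ suc))

sum-map-++ : ∀ {A : Set} (f : A → ℕ) (xs ys : List A) →
             sum (map f (xs ++ ys)) ≡ sum (map f xs) ℕ.+ sum (map f ys)
sum-map-++ f xs ys = trans (cong sum (map-++ f xs ys)) (sum-++ (map f xs) (map f ys))

sum-map-allFin : ∀ {A : Set} {n} (f : A → ℕ) (g : Fin n → A) →
                 sum (map f (map g (allFin n))) ≡ ∑[ i < n ] f (g i)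
sum-map-allFin {n = n} f g =
  trans (cong sum (sym (map-∘ (allFin n)))) (sum-map-tabulate (f ∘ g) id)

∑-const : ∀ n c → ∑[ i < n ] c ≡ n ℕ.* c
∑-const ℕ.zero    c = refl
∑-const (ℕ.suc n) c = cong (c ℕ.+_) (∑-const n c)

∑-mono-≤ : ∀ {n} {f g : Fin n → ℕ} → (∀ i → f i ℕ.≤ g i) →
           ∑[ i < n ] f i ℕ.≤ ∑[ i < n ] g i
∑-mono-≤ {ℕ.zero}  f≤g = ℕ.z≤n
∑-mono-≤ {ℕ.suc n} f≤g = ℕ.+-mono-≤ (f≤g zero) (∑-mono-≤ (f≤g ∘ suc))

∣tabulate∣≡∑ : ∀ {n} (p : Fin n → Bool) →
               ∣ Vec.tabulate p ∣ ≡ ∑[ i < n ] indicator (p i)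
∣tabulate∣≡∑ {ℕ.zero}  p = refl
∣tabulate∣≡∑ {ℕ.suc n} p with p zero
... | true  = cong ℕ.suc (∣tabulate∣≡∑ (p ∘ suc))
... | false = ∣tabulate∣≡∑ (p ∘ suc)

∈-tabulate : ∀ {n} {p : Fin n → Bool} i → p i ≡ true → i ∈ Vec.tabulate p
∈-tabulate {p = p} i pᵢ = lookup⇒[]= i _ (trans (lookup∘tabulate p i) pᵢ)

+-cancelˡ-≤ : ∀ i {j k} → i + j ≤ i + k → j ≤ k
+-cancelˡ-≤ i {j} {k} i+j≤i+k = begin
  j             ≡⟨ neg-+-cancel j ⟨
  - i + (i + j) ≤⟨ +-monoʳ-≤ (- i) i+j≤i+k ⟩
  - i + (i + k) ≡⟨ neg-+-cancel k ⟩
  k             ∎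
  where
  open ℤ.≤-Reasoning
  neg-+-cancel : ∀ x → - i + (i + x) ≡ x
  neg-+-cancel x = trans (sym (ℤ.+-assoc (- i) i x))
                         (trans (cong (_+ x) (ℤ.+-inverseˡ i)) (ℤ.+-identityˡ x))

card-split : ∀ {n m} (S : VSet n m) → let ι = indicator ∘ S in
  card S ≡ ι a ℕ.+ (ι b ℕ.+ (∑[ z < n ] ι (el z) ℕ.+
             (∑[ i < m ] ι (v i) ℕ.+ (∑[ i < m ] ι (u i) ℕ.+ ∑[ i < m ] ι (w i)))))
card-split {n} {m} S = cong (λ t → ι a ℕ.+ (ι b ℕ.+ t))
  (trans (sum-map-++ ι (map el (allFin n)) _) (cong₂ ℕ._+_ (sum-map-allFin ι el)
  (trans (sum-map-++ ι (map v (allFin m)) _) (cong₂ ℕ._+_ (sum-map-allFin ι v)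
  (trans (sum-map-++ ι (map u (allFin m)) _) (cong₂ ℕ._+_ (sum-map-allFin ι u)
    (sum-map-allFin ι w)))))))
  where
  ι = indicator ∘ S

_─el_ : ∀ {n m} → VSet n m → Fin n → VSet n m
(S ─el z) (el z′) = if does (z′ ≟ z) then false else S (el z′)
(S ─el z) x       = S x

─el-⊆ : ∀ {n m} (S : VSet n m) z → (S ─el z) ⊆V S
─el-⊆ S z (el z′) z′∈S with z′ ≟ z
... | no _ = z′∈S
─el-⊆ S z a     x∈S = x∈S
─el-⊆ S z b     x∈S = x∈S
─el-⊆ S z (v i) x∈S = x∈S
─el-⊆ S z (u i) x∈S = x∈S
─el-⊆ S z (w i) x∈S = x∈S

─el-removes : ∀ {n m} (S : VSet n m) z → (S ─el z) (el z) ≡ false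
─el-removes S z rewrite dec-true (z ≟ z) refl = refl

survives : ∀ {n m} → VSet n m → Fin m → Bool
survives S i = not (S (v i))

survivors : ∀ {n m} → VSet n m → Subset m
survivors S = Vec.tabulate (survives S)

module _ {n m : ℕ} {F : Fin m → Subset n} where

  a-v-common-neighbour∈S : ∀ {S x i} → Separator F S → Adj F a x → Adj F x (v i) →
                           S (v i) ≡ false → S x ≡ true
  a-v-common-neighbour∈S {i = i} (a∉S , b∉S , a↛b) a~x x~vᵢ vᵢ∉S =
    Bool.¬-not λ x∉S →
      a↛b (step (step (step (here a∉S) a~x x∉S) x~vᵢ vᵢ∉S) (inj₂ (b-v i)) b∉S)

  gadget-cost : ∀ {S} → Separator F S → ∀ i →
                1 ℕ.+ indicator (survives S i) ℕ.≤
                indicator (S (v i)) ℕ.+ (indicator (S (u i)) ℕ.+ indicator (S (w i)))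
  gadget-cost {S} sep i with S (v i) in S-vᵢ
  ... | true  = ℕ.s≤s ℕ.z≤n
  ... | false rewrite a-v-common-neighbour∈S sep (inj₁ (a-u i)) (inj₁ (u-v i)) S-vᵢ
                    | a-v-common-neighbour∈S sep (inj₁ (a-w i)) (inj₁ (w-v i)) S-vᵢ = ℕ.≤-refl

  card-lower-bound : ∀ {S} → Separator F S → (∀ z → S (el z) ≡ true) →
                     n ℕ.+ m ℕ.+ ∣ survivors S ∣ ℕ.≤ card S
  card-lower-bound {S} sep U⊆S = begin
    n ℕ.+ m ℕ.+ ∣ survivors S ∣
      ≡⟨ ℕ.+-assoc n m _ ⟩
    n ℕ.+ (m ℕ.+ ∣ survivors S ∣)
      ≡⟨ cong₂ ℕ._+_ (sym (∑-one n)) (cong₂ ℕ._+_ (sym (∑-one m)) (∣tabulate∣≡∑ (survives S))) ⟩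
    ∑[ z < n ] 1 ℕ.+ (∑[ i < m ] 1 ℕ.+ ∑[ i < m ] indicator (survives S i))
      ≡⟨ cong (∑[ z < n ] 1 ℕ.+_) (∑-distrib-+ (λ _ → 1) (indicator ∘ survives S)) ⟨
    ∑[ z < n ] 1 ℕ.+ ∑[ i < m ] (1 ℕ.+ indicator (survives S i))
      ≤⟨ ℕ.+-mono-≤ (∑-mono-≤ element-cost) (∑-mono-≤ (gadget-cost sep)) ⟩
    ∑[ z < n ] ι (el z) ℕ.+ ∑[ i < m ] (ι (v i) ℕ.+ (ι (u i) ℕ.+ ι (w i)))
      ≡⟨ cong (∑[ z < n ] ι (el z) ℕ.+_) gadgets-split ⟩
    ∑[ z < n ] ι (el z) ℕ.+ (∑[ i < m ] ι (v i) ℕ.+ (∑[ i < m ] ι (u i) ℕ.+ ∑[ i < m ] ι (w i)))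
      ≤⟨ ℕ.m≤n+m _ (ι a ℕ.+ ι b) ⟩
    ι a ℕ.+ ι b ℕ.+ _
      ≡⟨ ℕ.+-assoc (ι a) (ι b) _ ⟩
    ι a ℕ.+ (ι b ℕ.+ _)
      ≡⟨ card-split S ⟨
    card S ∎
    where
    open ℕ.≤-Reasoning
    ι = indicator ∘ S
    ∑-one : ∀ k → ∑[ i < k ] 1 ≡ k
    ∑-one k = trans (∑-const k 1) (ℕ.*-identityʳ k)
    element-cost : ∀ z → 1 ℕ.≤ ι (el z)
    element-cost z rewrite U⊆S z = ℕ.≤-refl
    gadgets-split : ∑[ i < m ] (ι (v i) ℕ.+ (ι (u i) ℕ.+ ι (w i))) ≡
                    ∑[ i < m ] ι (v i) ℕ.+ (∑[ i < m ] ι (u i) ℕ.+ ∑[ i < m ] ι (w i))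
    gadgets-split = trans (∑-distrib-+ (ι ∘ v) (λ i → ι (u i) ℕ.+ ι (w i)))
                          (cong (∑[ i < m ] ι (v i) ℕ.+_) (∑-distrib-+ (ι ∘ u) (ι ∘ w)))

  module _ {S : VSet n m} {z : Fin n} (a∉S : S a ≡ false)
           (uncovered : ∀ i → z ∈ F i → S (v i) ≡ true) where

    reach-─el : ∀ {y} → Reach F (S ─el z) a y → Reach F S a y ⊎ y ≡ el z
    reach-─el (here a∉S′) = inj₁ (here a∉S′)
    reach-─el (step r y~y′ y′∉S) with reach-─el r
    ... | inj₁ r′   = extend r′ y~y′ y′∉S
      where
      extend : ∀ {y y′} → Reach F S a y → Adj F y y′ → (S ─el z) y′ ≡ false →
               Reach F S a y′ ⊎ y′ ≡ el z
      extend {y′ = el z′} r y~y′ y′∉S with z′ ≟ z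
      ... | yes refl = inj₂ refl
      ... | no _     = inj₁ (step r y~y′ y′∉S)
      extend {y′ = a}   r y~y′ y′∉S = inj₁ (step r y~y′ y′∉S)
      extend {y′ = b}   r y~y′ y′∉S = inj₁ (step r y~y′ y′∉S)
      extend {y′ = v i} r y~y′ y′∉S = inj₁ (step r y~y′ y′∉S)
      extend {y′ = u i} r y~y′ y′∉S = inj₁ (step r y~y′ y′∉S)
      extend {y′ = w i} r y~y′ y′∉S = inj₁ (step r y~y′ y′∉S)
    ... | inj₂ refl = inj₁ (leave y~y′ y′∉S)
      where
      leave : ∀ {y′} → Adj F (el z) y′ → (S ─el z) y′ ≡ false → Reach F S a y′
      leave (inj₁ (el-v _ i z∈Fᵢ)) vᵢ∉S with () ← trans (sym vᵢ∉S) (uncovered i z∈Fᵢ)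
      leave (inj₂ (a-el _))        _    = here a∉S

  ─el-separator : ∀ {S z} → Separator F S → (∀ i → z ∈ F i → S (v i) ≡ true) →
                  Separator F (S ─el z)
  ─el-separator {S} {z} (a∉S , b∉S , a↛b) uncovered = a∉S , b∉S , a↛b′
    where
    a↛b′ : ¬ Reach F (S ─el z) a b
    a↛b′ r with reach-─el a∉S uncovered r
    ... | inj₁ r′ = a↛b r′
    ... | inj₂ ()

  minimal-separator-covers : ∀ {S z} → MinimalSeparator F S → S (el z) ≡ true →
                             ∃ λ i → S (v i) ≡ false × z ∈ F i
  minimal-separator-covers {S} {z} (sep , minimal) z∈S
    with any? (λ i → (S (v i) Bool.≟ false) ×-dec (z ∈? F i))
  ... | yes covered = covered
  ... | no uncovered = ⊥-elim (Bool.not-¬ (─el-removes S z) z∈S─z)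
    where
    z∈S─z : (S ─el z) (el z) ≡ true
    z∈S─z = minimal (S ─el z) (─el-⊆ S z)
              (─el-separator sep λ i z∈Fᵢ → Bool.¬-not λ vᵢ∉S → uncovered (i , vᵢ∉S , z∈Fᵢ))
              (el z) z∈S

lemma3 : (n m : ℕ) (F : Fin m → Subset n) → Injective _≡_ _≡_ F → (k : ℤ) →
    (∃ λ (S : VSet n m) → MinimalSeparator F S × S a ≡ false
       × (∀ (z : Fin n) → S (el z) ≡ true)
       × + card S ≤ (+ n + + m) + k) →
    ∃ λ (F' : Subset m) → + ∣ F' ∣ ≤ k
      × (∀ (z : Fin n) → ∃ λ (i : Fin m) → i ∈ F' × z ∈ F i)
lemma3 n m F _ k (S , minimal@(sep , _) , _ , U⊆S , ∣S∣≤) =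
  survivors S , ∣survivors∣≤k , covers
  where
  ∣survivors∣≤k : + ∣ survivors S ∣ ≤ k
  ∣survivors∣≤k = +-cancelˡ-≤ (+ n + + m) (begin
    + n + + m + + ∣ survivors S ∣      ≡⟨ cong (_+ + ∣ survivors S ∣) (pos-+ n m) ⟨
    + (n ℕ.+ m) + + ∣ survivors S ∣    ≡⟨ pos-+ (n ℕ.+ m) ∣ survivors S ∣ ⟨
    + (n ℕ.+ m ℕ.+ ∣ survivors S ∣)    ≤⟨ +≤+ (card-lower-bound sep U⊆S) ⟩
    + card S                          ≤⟨ ∣S∣≤ ⟩
    + n + + m + k                     ∎)
    where open ℤ.≤-Reasoning

  covers : ∀ z → ∃ λ i → i ∈ survivors S × z ∈ F i
  covers z with minimal-separator-covers minimal (U⊆S z)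
  ... | i , vᵢ∉S , z∈Fᵢ = i , ∈-tabulate i (cong not vᵢ∉S) , z∈Fᵢ
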